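{- Let $r\geqslant 3$ and $2\leqslant t\leqslant k-r$ be integers, let $n$ be a positive integer, and let $\mathcal{F}\subseteq\binom{[n]}{k}$ be an $r$-wise $t$-intersecting family with $\tau_t(\mathcal{F})=t+1$. Let $G$ be the $(t+1)$-uniform hypergraph whose edges are the $t$-covers of $\mathcal{F}$ of size $t+1$ and whose vertex set is the union of these edges, and let $H_1,\dots,H_\ell$ be its connected components. Suppose each $H_i$ is a clique with exactly $r+t$ vertices. If $\ell\geqslant 2$, then $N_{r+1,t}(\mathcal{F})=0$.
   Context: $\binom{[n]}{k}$ is the family of $k$-subsets of $[n]=\{1,\dots,n\}$. A family is $r$-wise $t$-intersecting if any $r$ of its members (not necessarily distinct) share at least $t$ elements. A set $T\subseteq[n]$ is a $t$-cover of $\mathcal{F}$ if $|T\cap F|\geqslant t$ for all $F\in\mathcal{F}$; $\tau_t(\mathcal{F})$ is the minimum size of a $t$-cover. A connected component $H$ of $G$ (with vertex set $V(H)$) is a clique if its edge set is $\binom{V(H)}{t+1}$. A $(r+1,t)$-triangle is a family $\{T_1,\dots,T_{r+1}\}$ of $r+1$ sets which is $r$-wise $t$-intersecting with $|T_1\cap\cdots\cap T_{r+1}|\leqslant t-1$; $N_{r+1,t}(\mathcal{F})$ is the number of $(r+1)$-element subfamilies of $\mathcal{F}$ that are $(r+1,t)$-triangles. -}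

module Defs where

open import Data.Empty using (⊥)
open import Data.Nat using (ℕ; suc; _+_; _∸_; _≤_)
open import Data.Fin using (Fin)
open import Data.Fin.Subset using (Subset; _∈_; _∉_; _⊆_; _∩_; ∣_∣; ⋂)
open import Data.List using (tabulate)
open import Data.Product using (Σ; ∃; _×_)
open import Relation.Binary.PropositionalEquality using (_≡_)
open import Relation.Binary.Construct.Closure.ReflexiveTransitive using (Star)
open import Function.Bundles using (_⇔_)
open import Function.Definitions using (Injective)

Family : ℕ → Set₁
Family n = Subset n → Set

⋂ᶠ : ∀ {n m} → (Fin m → Subset n) → Subset n
⋂ᶠ s = ⋂ (tabulate s)

Uniform : ∀ {n} → ℕ → Family n → Set
Uniform k 𝓕 = ∀ F → 𝓕 F → ∣ F ∣ ≡ k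

-- r-wise t-intersecting: any r members (not necessarily distinct) share ≥ t elements.
RWiseTIntersecting : ∀ {n} → ℕ → ℕ → Family n → Set
RWiseTIntersecting r t 𝓕 =
  (s : Fin r → Subset _) → (∀ i → 𝓕 (s i)) → t ≤ ∣ ⋂ᶠ s ∣

IsTCover : ∀ {n} → ℕ → Family n → Subset n → Set
IsTCover t 𝓕 T = ∀ F → 𝓕 F → t ≤ ∣ T ∩ F ∣

TauEq : ∀ {n} → ℕ → Family n → ℕ → Set
TauEq t 𝓕 m =
  (Σ (Subset _) λ T → IsTCover t 𝓕 T × ∣ T ∣ ≡ m)
  × (∀ T → IsTCover t 𝓕 T → m ≤ ∣ T ∣)

IsEdge : ∀ {n} → ℕ → Family n → Subset n → Set
IsEdge t 𝓕 E = IsTCover t 𝓕 E × ∣ E ∣ ≡ suc t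

IsVertex : ∀ {n} → ℕ → Family n → Fin n → Set
IsVertex t 𝓕 v = Σ (Subset _) λ E → IsEdge t 𝓕 E × v ∈ E

Adj : ∀ {n} → ℕ → Family n → Fin n → Fin n → Set
Adj t 𝓕 u v = Σ (Subset _) λ E → IsEdge t 𝓕 E × u ∈ E × v ∈ E

Conn : ∀ {n} → ℕ → Family n → Fin n → Fin n → Set
Conn t 𝓕 = Star (Adj t 𝓕)

IsComponent : ∀ {n} → ℕ → Family n → Subset n → Set
IsComponent t 𝓕 C =
  (∃ λ u → u ∈ C)
  × (∀ u → u ∈ C → IsVertex t 𝓕 u)
  × (∀ u v → u ∈ C → (v ∈ C ⇔ Conn t 𝓕 u v))

AreComponents : ∀ {n ℓ} → ℕ → Family n → (Fin ℓ → Subset n) → Set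
AreComponents t 𝓕 H =
  (∀ i → IsComponent t 𝓕 (H i))
  × Injective _≡_ _≡_ H
  × (∀ v → IsVertex t 𝓕 v → ∃ λ i → v ∈ H i)

-- The component with vertex set C is a clique: its edge set (edges of G inside C)
-- equals the set of all (t+1)-subsets of C.
IsClique : ∀ {n} → ℕ → Family n → Subset n → Set
IsClique t 𝓕 C = ∀ E → (E ⊆ C × IsEdge t 𝓕 E) ⇔ (E ⊆ C × ∣ E ∣ ≡ suc t)

Img : ∀ {n m} → (Fin m → Subset n) → Family n
Img T A = ∃ λ j → T j ≡ A

IsTriangle : ∀ {n} → (r : ℕ) → ℕ → (Fin (suc r) → Subset n) → Set
IsTriangle r t T = RWiseTIntersecting r t (Img T) × ∣ ⋂ᶠ T ∣ ≤ t ∸ 1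

-- N_{r+1,t}(𝓕) = 0 : no (r+1)-element subfamily of 𝓕 (given by an injective
-- indexing T_1,…,T_{r+1} of distinct members) is an (r+1,t)-triangle.
NoTriangles : ∀ {n} → ℕ → ℕ → Family n → Set
NoTriangles {n} r t 𝓕 =
  (T : Fin (suc r) → Subset n) → Injective _≡_ _≡_ T → (∀ j → 𝓕 (T j))
  → IsTriangle r t T → ⊥

-- Every (t+1)-subset of a clique component is a t-cover, so a member F of 𝓕
-- misses at most one vertex of each component: two missed vertices would lie
-- in a common (t+1)-subset meeting F in at most t - 1 points. Hence r + 1
-- members of 𝓕 share at least (r + t) - (r + 1) = t - 1 vertices of every
-- component, and with two disjoint components their common intersection has
-- at least 2(t - 1) > t - 1 elements, so they cannot form a triangle.
module Submission where

open import Defs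
open import Data.Fin using (Fin; zero; suc)
open import Data.Fin.Subset
  using (Subset; inside; outside; _∈_; _∉_; _⊆_; _∩_; _─_; ∣_∣)
open import Data.Fin.Subset.Properties
  using ( drop-∷-⊆; s⊆s; out⊆; ⊆-refl; ⊥⊆; ∣⊥∣≡0; p⊆q⇒∣p∣≤∣q∣; ⊆-antisym
        ; x∈p∩q⁻; ∩-comm; p─⊤≡⊥; p─q⊆p; x∈p∧x∉q⇒x∈p─q)
open import Data.Vec using ([]; _∷_; here; there)
open import Data.Nat using (ℕ; zero; suc; _+_; _∸_; _≤_; _<_; z≤n; s≤s; _≤?_)
open import Data.Nat.Properties
open import Data.Product using (_×_; _,_; proj₁; proj₂; ∃)
open import Function.Base using (_∘_)
open import Function.Bundles using (Equivalence)
open import Relation.Nullary using (yes; no; contradiction)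
open import Relation.Binary.PropositionalEquality
  using (_≡_; _≢_; refl; sym; trans; cong; subst)

x∈p─q⇒x∉q : ∀ {n} {x : Fin n} {p q : Subset n} → x ∈ p ─ q → x ∉ q
x∈p─q⇒x∉q {p = _ ∷ _} {q = outside ∷ _} here ()
x∈p─q⇒x∉q {p = _ ∷ _} {q = _ ∷ _} (there x∈p─q) (there x∈q) =
  x∈p─q⇒x∉q x∈p─q x∈q

∣p∩q∣+∣p─q∣≡∣p∣ : ∀ {n} (p q : Subset n) → ∣ p ∩ q ∣ + ∣ p ─ q ∣ ≡ ∣ p ∣
∣p∩q∣+∣p─q∣≡∣p∣ []            []            = refl
∣p∩q∣+∣p─q∣≡∣p∣ (inside  ∷ p) (inside  ∷ q) = cong suc (∣p∩q∣+∣p─q∣≡∣p∣ p q)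
∣p∩q∣+∣p─q∣≡∣p∣ (inside  ∷ p) (outside ∷ q) =
  trans (+-suc _ _) (cong suc (∣p∩q∣+∣p─q∣≡∣p∣ p q))
∣p∩q∣+∣p─q∣≡∣p∣ (outside ∷ p) (inside  ∷ q) = ∣p∩q∣+∣p─q∣≡∣p∣ p q
∣p∩q∣+∣p─q∣≡∣p∣ (outside ∷ p) (outside ∷ q) = ∣p∩q∣+∣p─q∣≡∣p∣ p q

∣p─q∩r∣≤∣p─q∣+∣p─r∣ : ∀ {n} (p q r : Subset n) → ∣ p ─ q ∩ r ∣ ≤ ∣ p ─ q ∣ + ∣ p ─ r ∣
∣p─q∩r∣≤∣p─q∣+∣p─r∣ []            []            []            = z≤n
∣p─q∩r∣≤∣p─q∣+∣p─r∣ (_       ∷ p) (inside  ∷ q) (inside  ∷ r) = ∣p─q∩r∣≤∣p─q∣+∣p─r∣ p q r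
∣p─q∩r∣≤∣p─q∣+∣p─r∣ (inside  ∷ p) (inside  ∷ q) (outside ∷ r) =
  ≤-trans (s≤s (∣p─q∩r∣≤∣p─q∣+∣p─r∣ p q r)) (≤-reflexive (sym (+-suc _ _)))
∣p─q∩r∣≤∣p─q∣+∣p─r∣ (outside ∷ p) (inside  ∷ q) (outside ∷ r) = ∣p─q∩r∣≤∣p─q∣+∣p─r∣ p q r
∣p─q∩r∣≤∣p─q∣+∣p─r∣ (inside  ∷ p) (outside ∷ q) (inside  ∷ r) = s≤s (∣p─q∩r∣≤∣p─q∣+∣p─r∣ p q r)
∣p─q∩r∣≤∣p─q∣+∣p─r∣ (inside  ∷ p) (outside ∷ q) (outside ∷ r) =
  s≤s (≤-trans (∣p─q∩r∣≤∣p─q∣+∣p─r∣ p q r) (+-monoʳ-≤ _ (n≤1+n _)))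
∣p─q∩r∣≤∣p─q∣+∣p─r∣ (outside ∷ p) (outside ∷ q) (inside  ∷ r) = ∣p─q∩r∣≤∣p─q∣+∣p─r∣ p q r
∣p─q∩r∣≤∣p─q∣+∣p─r∣ (outside ∷ p) (outside ∷ q) (outside ∷ r) = ∣p─q∩r∣≤∣p─q∣+∣p─r∣ p q r

∣p─⋂ᶠq∣≤m : ∀ {n m} (p : Subset n) (q : Fin m → Subset n) →
            (∀ j → ∣ p ─ q j ∣ ≤ 1) → ∣ p ─ ⋂ᶠ q ∣ ≤ m
∣p─⋂ᶠq∣≤m {n} {zero}  p q _   = ≤-reflexive (trans (cong ∣_∣ (p─⊤≡⊥ p)) (∣⊥∣≡0 n))
∣p─⋂ᶠq∣≤m {n} {suc m} p q p─q = begin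
  ∣ p ─ q zero ∩ ⋂ᶠ (q ∘ suc) ∣           ≤⟨ ∣p─q∩r∣≤∣p─q∣+∣p─r∣ p (q zero) (⋂ᶠ (q ∘ suc)) ⟩
  ∣ p ─ q zero ∣ + ∣ p ─ ⋂ᶠ (q ∘ suc) ∣   ≤⟨ +-mono-≤ (p─q zero) (∣p─⋂ᶠq∣≤m p (q ∘ suc) (p─q ∘ suc)) ⟩
  suc m                                   ∎
  where open ≤-Reasoning

∣p∣∸m≤∣p∩⋂ᶠq∣ : ∀ {n m} (p : Subset n) (q : Fin m → Subset n) →
                (∀ j → ∣ p ─ q j ∣ ≤ 1) → ∣ p ∣ ∸ m ≤ ∣ p ∩ ⋂ᶠ q ∣
∣p∣∸m≤∣p∩⋂ᶠq∣ {m = m} p q p─q = m≤n+o⇒m∸n≤o ∣ p ∣ m (begin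
  ∣ p ∣                           ≡⟨ sym (∣p∩q∣+∣p─q∣≡∣p∣ p (⋂ᶠ q)) ⟩
  ∣ p ∩ ⋂ᶠ q ∣ + ∣ p ─ ⋂ᶠ q ∣     ≡⟨ +-comm ∣ p ∩ ⋂ᶠ q ∣ ∣ p ─ ⋂ᶠ q ∣ ⟩
  ∣ p ─ ⋂ᶠ q ∣ + ∣ p ∩ ⋂ᶠ q ∣     ≤⟨ +-monoˡ-≤ ∣ p ∩ ⋂ᶠ q ∣ (∣p─⋂ᶠq∣≤m p q p─q) ⟩
  m + ∣ p ∩ ⋂ᶠ q ∣                ∎)
  where open ≤-Reasoning

∣p∩q∣+∣p∩r∣≤∣p∣ : ∀ {n} (p q r : Subset n) → (∀ {x} → x ∈ q → x ∉ r) →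
                  ∣ p ∩ q ∣ + ∣ p ∩ r ∣ ≤ ∣ p ∣
∣p∩q∣+∣p∩r∣≤∣p∣ p q r disjoint = begin
  ∣ p ∩ q ∣ + ∣ p ∩ r ∣  ≤⟨ +-monoʳ-≤ ∣ p ∩ q ∣ (p⊆q⇒∣p∣≤∣q∣ p∩r⊆p─q) ⟩
  ∣ p ∩ q ∣ + ∣ p ─ q ∣  ≡⟨ ∣p∩q∣+∣p─q∣≡∣p∣ p q ⟩
  ∣ p ∣                  ∎
  where
  open ≤-Reasoning
  p∩r⊆p─q : p ∩ r ⊆ p ─ q
  p∩r⊆p─q x∈p∩r with x∈p , x∈r ← x∈p∩q⁻ p r x∈p∩r =
    x∈p∧x∉q⇒x∈p─q x∈p (λ x∈q → disjoint x∈q x∈r)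

subset-of-size-between : ∀ {n} m {S C : Subset n} → S ⊆ C → ∣ S ∣ ≤ m → m ≤ ∣ C ∣ →
                         ∃ λ E → S ⊆ E × E ⊆ C × ∣ E ∣ ≡ m
subset-of-size-between _ {[]} {[]} _ _ z≤n = [] , (λ ()) , (λ ()) , refl
subset-of-size-between _ {inside ∷ S} {outside ∷ C} S⊆C _ _ = contradiction (S⊆C here) λ ()
subset-of-size-between (suc m) {inside ∷ S} {inside ∷ C} S⊆C (s≤s ∣S∣≤m) (s≤s m≤∣C∣)
  with E , S⊆E , E⊆C , ∣E∣≡m ← subset-of-size-between m (drop-∷-⊆ S⊆C) ∣S∣≤m m≤∣C∣ =
  inside ∷ E , s⊆s S⊆E , s⊆s E⊆C , cong suc ∣E∣≡m
subset-of-size-between m {outside ∷ S} {outside ∷ C} S⊆C ∣S∣≤m m≤∣C∣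
  with E , S⊆E , E⊆C , ∣E∣≡m ← subset-of-size-between m (drop-∷-⊆ S⊆C) ∣S∣≤m m≤∣C∣ =
  outside ∷ E , s⊆s S⊆E , s⊆s E⊆C , ∣E∣≡m
subset-of-size-between m {outside ∷ S} {inside ∷ C} S⊆C ∣S∣≤m m≤1+∣C∣ with m ≤? ∣ C ∣
... | yes m≤∣C∣ with E , S⊆E , E⊆C , ∣E∣≡m ← subset-of-size-between m (drop-∷-⊆ S⊆C) ∣S∣≤m m≤∣C∣ =
  outside ∷ E , s⊆s S⊆E , out⊆ E⊆C , ∣E∣≡m
... | no m≰∣C∣ =
  inside ∷ C , out⊆ (drop-∷-⊆ S⊆C) , ⊆-refl , ≤-antisym (≰⇒> m≰∣C∣) m≤1+∣C∣

∣clique─member∣≤1 : ∀ {n} {t : ℕ} {𝓕 : Family n} {C F : Subset n} →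
                    IsClique t 𝓕 C → suc t ≤ ∣ C ∣ → 1 ≤ t → 𝓕 F → ∣ C ─ F ∣ ≤ 1
∣clique─member∣≤1 {n} {t} {𝓕} {C} {F} clique t<∣C∣ 1≤t F∈𝓕 with 2 ≤? ∣ C ─ F ∣
... | no 2≰∣C─F∣ = ≤-pred (≰⇒> 2≰∣C─F∣)
... | yes 2≤∣C─F∣
  with D , _ , D⊆C─F , ∣D∣≡2 ←
         subset-of-size-between 2 ⊥⊆ (subst (_≤ 2) (sym (∣⊥∣≡0 n)) z≤n) 2≤∣C─F∣
  with E , D⊆E , E⊆C , ∣E∣≡1+t ←
         subset-of-size-between (suc t) (p─q⊆p C F ∘ D⊆C─F)
           (≤-trans (≤-reflexive ∣D∣≡2) (s≤s 1≤t)) t<∣C∣ =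
  contradiction (+-mono-≤ t≤∣E∩F∣ 2≤∣E─F∣) (<⇒≱ ∣E∣<t+2)
  where
  t≤∣E∩F∣ : t ≤ ∣ E ∩ F ∣
  t≤∣E∩F∣ = proj₁ (proj₂ (Equivalence.from (clique E) (E⊆C , ∣E∣≡1+t))) F F∈𝓕
  D⊆E─F : D ⊆ E ─ F
  D⊆E─F x∈D = x∈p∧x∉q⇒x∈p─q (D⊆E x∈D) (x∈p─q⇒x∉q (D⊆C─F x∈D))
  2≤∣E─F∣ : 2 ≤ ∣ E ─ F ∣
  2≤∣E─F∣ = subst (_≤ ∣ E ─ F ∣) ∣D∣≡2 (p⊆q⇒∣p∣≤∣q∣ D⊆E─F)
  ∣E∣<t+2 : ∣ E ∩ F ∣ + ∣ E ─ F ∣ < t + 2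
  ∣E∣<t+2 = subst (_< t + 2) (sym (trans (∣p∩q∣+∣p─q∣≡∣p∣ E F) ∣E∣≡1+t))
                  (≤-reflexive (sym (+-comm t 2)))

∣clique∣∸m≤∣clique∩⋂ᶠmembers∣ : ∀ {n m} {t : ℕ} {𝓕 : Family n} {C : Subset n} →
                                IsClique t 𝓕 C → suc t ≤ ∣ C ∣ → 1 ≤ t →
                                (T : Fin m → Subset n) → (∀ j → 𝓕 (T j)) →
                                ∣ C ∣ ∸ m ≤ ∣ C ∩ ⋂ᶠ T ∣
∣clique∣∸m≤∣clique∩⋂ᶠmembers∣ {C = C} clique t<∣C∣ 1≤t T T∈𝓕 =
  ∣p∣∸m≤∣p∩⋂ᶠq∣ C T (λ j → ∣clique─member∣≤1 clique t<∣C∣ 1≤t (T∈𝓕 j))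

component-⊆ : ∀ {n} {t : ℕ} {𝓕 : Family n} {C D : Subset n} {x : Fin n} →
              IsComponent t 𝓕 C → IsComponent t 𝓕 D → x ∈ C → x ∈ D → C ⊆ D
component-⊆ {x = x} (_ , _ , C-conn) (_ , _ , D-conn) x∈C x∈D y∈C =
  Equivalence.from (D-conn x _ x∈D) (Equivalence.to (C-conn x _ x∈C) y∈C)

distinct-components-disjoint : ∀ {n ℓ} {t : ℕ} {𝓕 : Family n} {H : Fin ℓ → Subset n} →
                               AreComponents t 𝓕 H → ∀ {i j} → i ≢ j → ∀ {x} → x ∈ H i → x ∉ H j
distinct-components-disjoint (component , injective , _) {i} {j} i≢j x∈Hi x∈Hj =
  i≢j (injective (⊆-antisym (component-⊆ (component i) (component j) x∈Hi x∈Hj)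
                            (component-⊆ (component j) (component i) x∈Hj x∈Hi)))

lemma4p7 : (n k r t : ℕ) → 3 ≤ r → 2 ≤ t → t + r ≤ k → 1 ≤ n
    → (𝓕 : Family n) → Uniform k 𝓕 → RWiseTIntersecting r t 𝓕
    → TauEq t 𝓕 (suc t)
    → (ℓ : ℕ) → (H : Fin ℓ → Subset n) → AreComponents t 𝓕 H
    → (∀ i → IsClique t 𝓕 (H i) × ∣ H i ∣ ≡ r + t)
    → 2 ≤ ℓ
    → NoTriangles r t 𝓕
lemma4p7 n k r t 3≤r 2≤t _ _ 𝓕 _ _ _ (suc (suc ℓ)) H components cliques (s≤s (s≤s _))
         T _ T∈𝓕 (_ , ∣X∣≤t∸1) =
  <⇒≱ (m<m+n (t ∸ 1) (∸-monoˡ-≤ 1 2≤t)) (begin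
    (t ∸ 1) + (t ∸ 1)                     ≤⟨ +-mono-≤ (meets zero) (meets (suc zero)) ⟩
    ∣ X ∩ H zero ∣ + ∣ X ∩ H (suc zero) ∣ ≤⟨ ∣p∩q∣+∣p∩r∣≤∣p∣ X _ _
                                               (distinct-components-disjoint components λ ()) ⟩
    ∣ X ∣                                 ≤⟨ ∣X∣≤t∸1 ⟩
    t ∸ 1                                 ∎)
  where
  open ≤-Reasoning
  X : Subset n
  X = ⋂ᶠ T
  meets : ∀ i → t ∸ 1 ≤ ∣ X ∩ H i ∣
  meets i = begin
    t ∸ 1               ≡⟨ sym ([m+n]∸[m+o]≡n∸o r t 1) ⟩
    (r + t) ∸ (r + 1)   ≡⟨ cong ((r + t) ∸_) (+-comm r 1) ⟩
    (r + t) ∸ suc r     ≡⟨ cong (_∸ suc r) (sym ∣Hi∣≡r+t) ⟩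
    ∣ H i ∣ ∸ suc r     ≤⟨ ∣clique∣∸m≤∣clique∩⋂ᶠmembers∣ clique t<∣Hi∣ 1≤t T T∈𝓕 ⟩
    ∣ H i ∩ X ∣         ≡⟨ cong ∣_∣ (∩-comm (H i) X) ⟩
    ∣ X ∩ H i ∣         ∎
    where
    clique : IsClique t 𝓕 (H i)
    clique = proj₁ (cliques i)
    ∣Hi∣≡r+t : ∣ H i ∣ ≡ r + t
    ∣Hi∣≡r+t = proj₂ (cliques i)
    1≤t : 1 ≤ t
    1≤t = ≤-trans (s≤s z≤n) 2≤t
    t<∣Hi∣ : suc t ≤ ∣ H i ∣
    t<∣Hi∣ = subst (suc t ≤_) (sym ∣Hi∣≡r+t) (+-monoˡ-≤ t (≤-trans (s≤s z≤n) 3≤r))
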